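{- Let $G$ and $H$ be graphs with $|V(G)|=n\ge 1$ and $|V(H)|\ge 1$. Let $G\circ H$ be their corona: the disjoint union of $G$ and $n$ copies of $H$, one copy $H_v$ for each vertex $v$ of $G$, where each $v\in V(G)$ is joined by an edge to every vertex of $H_v$. Then, as an identity of rational functions in $x$, $$\mathrm{ID}(G\circ H,x)=\mathrm{ID}(H,x)^{n}\, I\!\left(G,\frac{x}{\mathrm{ID}(H,x)}\right).$$
   Context: All graphs are finite, simple and undirected. A set $W\subseteq V$ is an independent dominating set of $G=(V,E)$ if every vertex of $V\setminus W$ is adjacent to at least one vertex of $W$ and no two vertices of $W$ are adjacent. The independent domination polynomial is $\mathrm{ID}(G,x)=\sum_{W}x^{|W|}$, the sum over all independent dominating sets $W$ of $G$. The independence polynomial is $I(G,x)=\sum_{S}x^{|S|}$, the sum over all independent sets $S$ of $G$, including $S=\emptyset$. -}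

module Defs where

open import Data.Bool using (Bool; true; false; _∧_; _∨_; not; if_then_else_)
open import Data.Nat using (ℕ; zero; suc) renaming (_+_ to _+ℕ_; _*_ to _*ℕ_)
open import Data.Fin using (Fin; zero; suc; splitAt; quotient; remainder)
open import Data.Fin.Properties using (_≟_)
open import Data.List using (List; []; _∷_; map; _++_; foldr; allFin)
open import Data.Bool.ListAction using (all; any)
open import Data.Product using (_×_; _,_)
open import Data.Sum using (_⊎_; inj₁; inj₂)
open import Data.Rational using (ℚ; 0ℚ; 1ℚ; _+_; _*_)
open import Relation.Nullary.Decidable using (⌊_⌋; yes; no)
open import Relation.Binary.PropositionalEquality using (_≡_; refl; sym; cong₂)

record Graph (n : ℕ) : Set where
  field
    adj        : Fin n → Fin n → Bool
    adj-sym    : ∀ u v → adj u v ≡ adj v u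
    adj-irrefl : ∀ v → adj v v ≡ false
open Graph public

Subset : ℕ → Set
Subset n = Fin n → Bool

allSubsets : (n : ℕ) → List (Subset n)
allSubsets zero    = (λ ()) ∷ []
allSubsets (suc n) = map (extend false) (allSubsets n) ++ map (extend true) (allSubsets n)
  where
  extend : Bool → Subset n → Subset (suc n)
  extend b S zero    = b
  extend b S (suc i) = S i

card : ∀ {n} → Subset n → ℕ
card {n} W = foldr (λ i k → if W i then suc k else k) zero (allFin n)

isIndependent : ∀ {n} → Graph n → Subset n → Bool
isIndependent {n} G W =
  all (λ u → all (λ v → not (W u ∧ W v ∧ adj G u v)) (allFin n)) (allFin n)

isDominating : ∀ {n} → Graph n → Subset n → Bool
isDominating {n} G W =
  all (λ v → W v ∨ any (λ u → W u ∧ adj G v u) (allFin n)) (allFin n)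

_^_ : ℚ → ℕ → ℚ
x ^ zero  = 1ℚ
x ^ suc k = x * (x ^ k)

sumℚ : List ℚ → ℚ
sumℚ = foldr _+_ 0ℚ

I : ∀ {n} → Graph n → ℚ → ℚ
I {n} G x = sumℚ (map (λ S → if isIndependent G S then x ^ card S else 0ℚ) (allSubsets n))

ID : ∀ {n} → Graph n → ℚ → ℚ
ID {n} G x = sumℚ (map (λ W → if isIndependent G W ∧ isDominating G W then x ^ card W else 0ℚ) (allSubsets n))

_=ᶠ_ : ∀ {n} → Fin n → Fin n → Bool
i =ᶠ j = ⌊ i ≟ j ⌋

=ᶠ-sym : ∀ {n} (i j : Fin n) → (i =ᶠ j) ≡ (j =ᶠ i)
=ᶠ-sym i j with i ≟ j | j ≟ i
... | yes _ | yes _ = refl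
... | no _  | no _  = refl
... | yes refl | no ¬p = Data.Empty.⊥-elim (¬p refl)
  where import Data.Empty
... | no ¬p | yes refl = Data.Empty.⊥-elim (¬p refl)
  where import Data.Empty

=ᶠ-refl : ∀ {n} (i : Fin n) → (i =ᶠ i) ≡ true
=ᶠ-refl i with i ≟ i
... | yes _ = refl
... | no ¬p = Data.Empty.⊥-elim (¬p refl)
  where import Data.Empty

-- Vertex set Fin (n + n * m) = V(G) ⊎ (V(G) × V(H)) via splitAt/remQuot:
-- a vertex a with splitAt n a = inj₁ v is the vertex v of G; a vertex with
-- splitAt n a = inj₂ p, where remQuot m p = (v , h), is the copy of vertex h of H
-- lying in the copy H_v attached to v ∈ V(G).
coronaAdj′ : ∀ {n m} → Graph n → Graph m → Fin n ⊎ Fin (n *ℕ m) → Fin n ⊎ Fin (n *ℕ m) → Bool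
coronaAdj′ G H (inj₁ u) (inj₁ v) = adj G u v
coronaAdj′ {n} {m} G H (inj₁ u) (inj₂ q) = u =ᶠ quotient {n} m q
coronaAdj′ {n} {m} G H (inj₂ p) (inj₁ v) = quotient {n} m p =ᶠ v
coronaAdj′ {n} {m} G H (inj₂ p) (inj₂ q) =
  (quotient {n} m p =ᶠ quotient {n} m q) ∧ adj H (remainder {n} m p) (remainder {n} m q)

coronaAdj : ∀ {n m} → Graph n → Graph m → Fin (n +ℕ n *ℕ m) → Fin (n +ℕ n *ℕ m) → Bool
coronaAdj {n} G H a b = coronaAdj′ G H (splitAt n a) (splitAt n b)

coronaAdj′-sym : ∀ {n m} (G : Graph n) (H : Graph m) a b → coronaAdj′ G H a b ≡ coronaAdj′ G H b a
coronaAdj′-sym G H (inj₁ u) (inj₁ v) = adj-sym G u v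
coronaAdj′-sym {n} {m} G H (inj₁ u) (inj₂ q) = =ᶠ-sym u (quotient {n} m q)
coronaAdj′-sym {n} {m} G H (inj₂ p) (inj₁ v) = =ᶠ-sym (quotient {n} m p) v
coronaAdj′-sym {n} {m} G H (inj₂ p) (inj₂ q) =
  cong₂ _∧_ (=ᶠ-sym (quotient {n} m p) (quotient {n} m q)) (adj-sym H (remainder {n} m p) (remainder {n} m q))

coronaAdj′-irrefl : ∀ {n m} (G : Graph n) (H : Graph m) a → coronaAdj′ G H a a ≡ false
coronaAdj′-irrefl G H (inj₁ u) = adj-irrefl G u
coronaAdj′-irrefl {n} {m} G H (inj₂ p) =
  cong₂ _∧_ (=ᶠ-refl (quotient {n} m p)) (adj-irrefl H (remainder {n} m p))

corona : ∀ {n m} → Graph n → Graph m → Graph (n +ℕ n *ℕ m)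
corona {n} G H = record
  { adj = coronaAdj G H
  ; adj-sym = λ a b → coronaAdj′-sym G H (splitAt n a) (splitAt n b)
  ; adj-irrefl = λ a → coronaAdj′-irrefl G H (splitAt n a) }

module Submission where

-- Write a subset W of V(G∘H) as its trace S = W ∩ V(G) together with the traces
-- T_v = W ∩ V(H_v) on the copies of H.  When H has at least one vertex, W is an
-- independent dominating set (IDS) of G∘H exactly when S is independent in G and,
-- for every v ∈ V(G), T_v is empty if v ∈ S and T_v is an IDS of H_v if v ∉ S
-- (lemma corona-IDS).  Since |W| = |S| + Σ_v |T_v|, the weight x^|W| of an IDS
-- factorises over the copies, and summing over the T_v independently gives
--   ID(G∘H,x) = Σ_{S indep.} x^|S| · Π_{v ∈ S} 1 · Π_{v ∉ S} ID(H,x)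
--             = ID(H,x)^n · Σ_{S indep.} (x / ID(H,x))^|S|.
--
-- Subsets are functions Fin n → Bool, so in the
-- absence of function extensionality sums are only congruent for weights that respect
-- pointwise equality of subsets; this is tracked by the predicate Respects≐.

open import Defs
open import Algebra.Bundles using (CommutativeMonoid)
open import Data.Bool using (Bool; true; false; T; _∧_; _∨_; not; if_then_else_)
open import Data.Bool.Properties using (T-∧; T-∨; T?)
open import Data.Empty using (⊥-elim)
open import Data.Fin using (Fin; zero; suc; splitAt; _↑ˡ_; _↑ʳ_; combine; quotient; remainder)
open import Data.Fin.Properties using (splitAt-↑ˡ; splitAt-↑ʳ; splitAt⁻¹-↑ˡ; splitAt⁻¹-↑ʳ; remQuot-combine; combine-remQuot)
open import Data.List using ([]; _∷_; map; _++_; foldr; allFin; tabulate)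
open import Data.List.Properties using (map-++; map-cong; map-∘)
open import Data.Bool.ListAction using (all; any)
import Data.List.Relation.Unary.All.Properties as All
import Data.List.Relation.Unary.Any.Properties as Any
open import Data.Nat using (ℕ; zero; suc; _≤_; s≤s) renaming (_+_ to _+ℕ_; _*_ to _*ℕ_)
open import Data.Product using (_×_; _,_; proj₁; proj₂; ∃-syntax)
open import Data.Rational using (ℚ; NonZero; _*_; _÷_; _+_; 0ℚ; 1ℚ; 1/_)
open import Data.Rational.Properties using (*-assoc; *-comm; *-identityˡ; *-identityʳ; *-zeroˡ; *-zeroʳ; *-distribˡ-+; +-identityˡ; +-identityʳ; +-assoc; *-inverseʳ; *-1-commutativeMonoid)
open import Data.Sum using (_⊎_; inj₁; inj₂; [_,_]′; map₂)
open import Function using (_∘_; _⇔_; mk⇔; Equivalence)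
open import Relation.Nullary using (¬_; yes; no)
open import Relation.Nullary.Decidable using (toWitness; fromWitness)
open import Relation.Binary.PropositionalEquality using (_≡_; refl; sym; trans; cong; cong₂; subst; module ≡-Reasoning)
open import Algebra.Properties.CommutativeSemigroup (CommutativeMonoid.commutativeSemigroup *-1-commutativeMonoid) using (interchange)

open Equivalence using (to; from)
open ≡-Reasoning

sumℚ-++ : ∀ xs ys → sumℚ (xs ++ ys) ≡ sumℚ xs + sumℚ ys
sumℚ-++ []       ys = sym (+-identityˡ _)
sumℚ-++ (x ∷ xs) ys = trans (cong (x +_) (sumℚ-++ xs ys)) (sym (+-assoc x _ _))

sumℚ-scale : ∀ c xs → c * sumℚ xs ≡ sumℚ (map (c *_) xs)
sumℚ-scale c []       = *-zeroʳ c
sumℚ-scale c (x ∷ xs) = trans (*-distribˡ-+ c x _) (cong (c * x +_) (sumℚ-scale c xs))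

ΣSub : (n : ℕ) → (Subset n → ℚ) → ℚ
ΣSub n f = sumℚ (map f (allSubsets n))

_≐_ : ∀ {n} → Subset n → Subset n → Set
S ≐ S′ = ∀ i → S i ≡ S′ i

Respects≐ : ∀ {n} → (Subset n → ℚ) → Set
Respects≐ f = ∀ {S S′} → S ≐ S′ → f S ≡ f S′

ΣSub-cong : ∀ n {f g : Subset n → ℚ} → (∀ S → f S ≡ g S) → ΣSub n f ≡ ΣSub n g
ΣSub-cong n f≡g = cong sumℚ (map-cong f≡g (allSubsets n))

ΣSub-scale : ∀ n c (f : Subset n → ℚ) → c * ΣSub n f ≡ ΣSub n (λ S → c * f S)
ΣSub-scale n c f = trans (sumℚ-scale c (map f L)) (cong sumℚ (sym (map-∘ L)))
  where L = allSubsets n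

ΣSub-scaleʳ : ∀ n c (f : Subset n → ℚ) → ΣSub n f * c ≡ ΣSub n (λ S → f S * c)
ΣSub-scaleʳ n c f =
  trans (*-comm _ c) (trans (ΣSub-scale n c f) (ΣSub-cong n (λ S → *-comm c (f S))))

ΣSub-zero : ∀ n → ΣSub n (λ _ → 0ℚ) ≡ 0ℚ
ΣSub-zero n = go (allSubsets n)
  where
  go : ∀ L → sumℚ (map (λ _ → 0ℚ) L) ≡ 0ℚ
  go []      = refl
  go (_ ∷ L) = trans (cong (0ℚ +_) (go L)) (+-identityˡ 0ℚ)

extend : ∀ {n} → Bool → Subset n → Subset (suc n)
extend b S zero    = b
extend b S (suc i) = S i

sum-relabel : ∀ {k l} (f : Subset l → ℚ) → Respects≐ f → {g h : Subset k → Subset l} →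
  (∀ S → g S ≐ h S) → ∀ L → sumℚ (map f (map g L)) ≡ sumℚ (map (f ∘ h) L)
sum-relabel f f-resp g≐h L =
  cong sumℚ (trans (sym (map-∘ L)) (map-cong (λ S → f-resp (g≐h S)) L))

ΣSub-suc : ∀ n (f : Subset (suc n) → ℚ) → Respects≐ f →
  ΣSub (suc n) f ≡ ΣSub n (f ∘ extend false) + ΣSub n (f ∘ extend true)
ΣSub-suc n f f-resp =
  trans (cong sumℚ (map-++ f (map _ L) (map _ L)))
  (trans (sumℚ-++ (map f (map _ L)) (map f (map _ L)))
  (cong₂ _+_ (sum-relabel f f-resp (λ S → λ { zero → refl ; (suc i) → refl }) L)
             (sum-relabel f f-resp (λ S → λ { zero → refl ; (suc i) → refl }) L)))
  where L = allSubsets n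

_⊕_ : ∀ {a b} → Subset a → Subset b → Subset (a +ℕ b)
_⊕_ {a} S T i = [ S , T ]′ (splitAt a i)

⊕-cong : ∀ {a b} {S S′ : Subset a} {T T′ : Subset b} → S ≐ S′ → T ≐ T′ → (S ⊕ T) ≐ (S′ ⊕ T′)
⊕-cong {a} S≐S′ T≐T′ i with splitAt a i
... | inj₁ j = S≐S′ j
... | inj₂ j = T≐T′ j

⊕-extend : ∀ a {b} c (S : Subset a) (T : Subset b) → extend c (S ⊕ T) ≐ (extend c S ⊕ T)
⊕-extend a c S T zero = refl
⊕-extend a c S T (suc i) with splitAt a i
... | inj₁ _ = refl
... | inj₂ _ = refl

⊕-left : ∀ a b (S : Subset a) (T : Subset b) i → (S ⊕ T) (i ↑ˡ b) ≡ S i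
⊕-left a b S T i rewrite splitAt-↑ˡ a i b = refl

⊕-right : ∀ a b (S : Subset a) (T : Subset b) j → (S ⊕ T) (a ↑ʳ j) ≡ T j
⊕-right a b S T j rewrite splitAt-↑ʳ a b j = refl

ΣSub-split : ∀ a b (F : Subset (a +ℕ b) → ℚ) → Respects≐ F →
  ΣSub (a +ℕ b) F ≡ ΣSub a (λ S → ΣSub b (λ T → F (S ⊕ T)))
ΣSub-split zero    b F F-resp = sym (+-identityʳ _)
ΣSub-split (suc a) b F F-resp = begin
  ΣSub (suc a +ℕ b) F
    ≡⟨ ΣSub-suc (a +ℕ b) F F-resp ⟩
  ΣSub (a +ℕ b) (F ∘ extend false) + ΣSub (a +ℕ b) (F ∘ extend true)
    ≡⟨ cong₂ _+_ (half false) (half true) ⟩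
  ΣSub a (λ S → ΣSub b (λ T → F (extend false S ⊕ T))) + ΣSub a (λ S → ΣSub b (λ T → F (extend true S ⊕ T)))
    ≡⟨ sym (ΣSub-suc a (λ S → ΣSub b (λ T → F (S ⊕ T)))
             (λ S≐S′ → ΣSub-cong b (λ T → F-resp (⊕-cong S≐S′ (λ _ → refl))))) ⟩
  ΣSub (suc a) (λ S → ΣSub b (λ T → F (S ⊕ T))) ∎
  where
  half : ∀ c → ΣSub (a +ℕ b) (F ∘ extend c) ≡ ΣSub a (λ S → ΣSub b (λ T → F (extend c S ⊕ T)))
  half c = trans (ΣSub-split a b (F ∘ extend c) (λ e → F-resp λ { zero → refl ; (suc i) → e i }))
                 (ΣSub-cong a (λ S → ΣSub-cong b (λ T → F-resp (⊕-extend a c S T))))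

Π : (n : ℕ) → (Fin n → ℚ) → ℚ
Π zero    f = 1ℚ
Π (suc n) f = f zero * Π n (f ∘ suc)

Π-cong : ∀ n {f g : Fin n → ℚ} → (∀ i → f i ≡ g i) → Π n f ≡ Π n g
Π-cong zero    f≡g = refl
Π-cong (suc n) f≡g = cong₂ _*_ (f≡g zero) (Π-cong n (f≡g ∘ suc))

Π-+ : ∀ a b (f : Fin (a +ℕ b) → ℚ) → Π (a +ℕ b) f ≡ Π a (λ i → f (i ↑ˡ b)) * Π b (λ j → f (a ↑ʳ j))
Π-+ zero    b f = sym (*-identityˡ _)
Π-+ (suc a) b f = trans (cong (f zero *_) (Π-+ a b (f ∘ suc))) (sym (*-assoc (f zero) _ _))

Π-blocks : ∀ n m (f : Fin (n *ℕ m) → ℚ) → Π (n *ℕ m) f ≡ Π n (λ v → Π m (λ h → f (combine v h)))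
Π-blocks zero    m f = refl
Π-blocks (suc n) m f =
  trans (Π-+ m (n *ℕ m) f) (cong (Π m (λ h → f (h ↑ˡ (n *ℕ m))) *_) (Π-blocks n m (λ j → f (m ↑ʳ j))))

Π-mul : ∀ n (f g : Fin n → ℚ) → Π n f * Π n g ≡ Π n (λ i → f i * g i)
Π-mul zero    f g = *-identityˡ 1ℚ
Π-mul (suc n) f g =
  trans (interchange (f zero) (Π n (f ∘ suc)) (g zero) (Π n (g ∘ suc)))
        (cong (f zero * g zero *_) (Π-mul n (f ∘ suc) (g ∘ suc)))

Π-const : ∀ n (d : ℚ) → Π n (λ _ → d) ≡ d ^ n
Π-const zero    d = refl
Π-const (suc n) d = cong (d *_) (Π-const n d)

Π-indicator : ∀ {k} n (c : Fin k → Bool) (g : Fin n → Fin k) (y : Fin n → ℚ) →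
  Π n (λ i → if c (g i) then y i else 0ℚ) ≡ (if all c (tabulate g) then Π n y else 0ℚ)
Π-indicator zero    c g y = refl
Π-indicator (suc n) c g y with c (g zero)
... | true  = trans (cong (y zero *_) (Π-indicator n c (g ∘ suc) (y ∘ suc))) (distrib (all c (tabulate (g ∘ suc))))
  where
  distrib : ∀ b → y zero * (if b then Π n (y ∘ suc) else 0ℚ) ≡ (if b then Π (suc n) y else 0ℚ)
  distrib true  = refl
  distrib false = *-zeroʳ (y zero)
... | false = *-zeroˡ (Π n (λ i → if c (g (suc i)) then y (suc i) else 0ℚ))

^-card : ∀ {n} (x : ℚ) (S : Subset n) → x ^ card S ≡ Π n (λ i → if S i then x else 1ℚ)
^-card {n} x S = go n (λ i → i)
  where
  go : ∀ k (g : Fin k → Fin n) →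
    x ^ foldr (λ i c → if S i then suc c else c) zero (tabulate g) ≡ Π k (λ j → if S (g j) then x else 1ℚ)
  go zero    g = refl
  go (suc k) g with S (g zero)
  ... | true  = cong (x *_) (go k (g ∘ suc))
  ... | false = trans (go k (g ∘ suc)) (sym (*-identityˡ _))

slice : ∀ {n m} → Subset (n *ℕ m) → Fin n → Subset m
slice T v h = T (combine v h)

ΣΠ : ∀ n m (ψ : Fin n → Subset m → ℚ) → (∀ v → Respects≐ (ψ v)) →
  ΣSub (n *ℕ m) (λ T → Π n (λ v → ψ v (slice T v))) ≡ Π n (λ v → ΣSub m (ψ v))
ΣΠ zero    m ψ ψ-resp = +-identityʳ 1ℚ
ΣΠ (suc n) m ψ ψ-resp = begin
  ΣSub (m +ℕ n *ℕ m) (λ T → Π (suc n) (λ v → ψ v (slice T v)))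
    ≡⟨ ΣSub-split m (n *ℕ m) _ (λ e → Π-cong (suc n) (λ v → ψ-resp v (λ h → e (combine v h)))) ⟩
  ΣSub m (λ U → ΣSub (n *ℕ m) (λ T → Π (suc n) (λ v → ψ v (slice (U ⊕ T) v))))
    ≡⟨ ΣSub-cong m (λ U → trans (ΣSub-cong (n *ℕ m) (first-block U)) (sym (ΣSub-scale (n *ℕ m) (ψ zero U) rest))) ⟩
  ΣSub m (λ U → ψ zero U * ΣSub (n *ℕ m) rest)
    ≡⟨ sym (ΣSub-scaleʳ m (ΣSub (n *ℕ m) rest) (ψ zero)) ⟩
  ΣSub m (ψ zero) * ΣSub (n *ℕ m) rest
    ≡⟨ cong (ΣSub m (ψ zero) *_) (ΣΠ n m (ψ ∘ suc) (ψ-resp ∘ suc)) ⟩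
  Π (suc n) (λ v → ΣSub m (ψ v)) ∎
  where
  rest : Subset (n *ℕ m) → ℚ
  rest T = Π n (λ v → ψ (suc v) (slice T v))
  first-block : ∀ U T → Π (suc n) (λ v → ψ v (slice (U ⊕ T) v)) ≡ ψ zero U * rest T
  first-block U T =
    cong₂ _*_ (ψ-resp zero (⊕-left m (n *ℕ m) U T))
              (Π-cong n (λ v → ψ-resp (suc v) (λ h → ⊕-right m (n *ℕ m) U T (combine v h))))

-- The weight of a subset W with respect to a Boolean property p: x^|W| if p W, else 0.
-- Thus I G x = ΣSub n (weight x (isIndependent G)) and ID G x = ΣSub n (weight x (isIDS G)).
weight : ℚ → ∀ {k} → (Subset k → Bool) → Subset k → ℚ
weight x p W = if p W then x ^ card W else 0ℚ

weight-resp : ∀ {k} x (p : Subset k → Bool) → (∀ {S S′} → S ≐ S′ → p S ≡ p S′) → Respects≐ (weight x p)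
weight-resp {k} x p p-resp {S} {S′} S≐S′ =
  cong₂ (λ b y → if b then y else 0ℚ) (p-resp S≐S′)
    (trans (^-card x S) (trans (Π-cong k (λ i → cong (λ b → if b then x else 1ℚ) (S≐S′ i))) (sym (^-card x S′))))

weight-rescale : ∀ {n} (d x : ℚ) .{{_ : NonZero d}} (p : Subset n → Bool) (S : Subset n) →
  weight x p S * Π n (λ v → if S v then 1ℚ else d) ≡ d ^ n * weight (x ÷ d) p S
weight-rescale {n} d x p S with p S
... | false = trans (*-zeroˡ (Π n (λ v → if S v then 1ℚ else d))) (sym (*-zeroʳ (d ^ n)))
... | true  = begin
  x ^ card S * Π n (λ v → if S v then 1ℚ else d)
    ≡⟨ cong (_* _) (^-card x S) ⟩
  Π n (λ v → if S v then x else 1ℚ) * Π n (λ v → if S v then 1ℚ else d)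
    ≡⟨ Π-mul n _ _ ⟩
  Π n (λ v → (if S v then x else 1ℚ) * (if S v then 1ℚ else d))
    ≡⟨ Π-cong n (λ v → factor (S v)) ⟩
  Π n (λ v → d * (if S v then x ÷ d else 1ℚ))
    ≡⟨ sym (Π-mul n _ _) ⟩
  Π n (λ _ → d) * Π n (λ v → if S v then x ÷ d else 1ℚ)
    ≡⟨ cong₂ _*_ (Π-const n d) (sym (^-card (x ÷ d) S)) ⟩
  d ^ n * (x ÷ d) ^ card S ∎
  where
  d*x÷d : d * (x ÷ d) ≡ x
  d*x÷d = trans (cong (d *_) (*-comm x (1/ d)))
            (trans (sym (*-assoc d (1/ d) x)) (trans (cong (_* x) (*-inverseʳ d)) (*-identityˡ x)))
  factor : ∀ b → (if b then x else 1ℚ) * (if b then 1ℚ else d) ≡ d * (if b then x ÷ d else 1ℚ)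
  factor true  = trans (*-identityʳ x) (sym d*x÷d)
  factor false = trans (*-identityˡ d) (sym (*-identityʳ d))

all-allFin : ∀ {k} (c : Fin k → Bool) → T (all c (allFin k)) ⇔ (∀ i → T (c i))
all-allFin c = mk⇔ (λ t → All.tabulate⁻ (All.all⁺ c _ t)) (λ f → All.all⁻ c (All.tabulate⁺ f))

any-allFin : ∀ {k} (c : Fin k → Bool) → T (any c (allFin k)) ⇔ (∃[ i ] T (c i))
any-allFin c = mk⇔ (λ t → Any.tabulate⁻ (Any.any⁻ c _ t)) (λ (i , t) → Any.any⁺ c (Any.tabulate⁺ i t))

=ᶠ-reflects : ∀ {k} {u v : Fin k} → T (u =ᶠ v) ⇔ (u ≡ v)
=ᶠ-reflects = mk⇔ toWitness fromWitness

not-∧∧ : ∀ {a b c} → T (not (a ∧ b ∧ c)) ⇔ (T a → T b → ¬ T c)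
not-∧∧ {true}  {true}  {true}  = mk⇔ (λ ()) (λ f → f _ _ _)
not-∧∧ {true}  {true}  {false} = mk⇔ (λ _ _ _ ()) (λ _ → _)
not-∧∧ {true}  {false}         = mk⇔ (λ _ _ ()) (λ _ → _)
not-∧∧ {false}                 = mk⇔ (λ _ ()) (λ _ → _)

T-ext : ∀ {a b} → (T a ⇔ T b) → a ≡ b
T-ext {true}  {true}  _   = refl
T-ext {true}  {false} a⇔b = ⊥-elim (to a⇔b _)
T-ext {false} {true}  a⇔b = ⊥-elim (from a⇔b _)
T-ext {false} {false} _   = refl

Independent : ∀ {k} → Graph k → Subset k → Set
Independent {k} G W = ∀ u v → T (W u) → T (W v) → ¬ T (adj G u v)

Dominating : ∀ {k} → Graph k → Subset k → Set
Dominating {k} G W = ∀ v → T (W v) ⊎ ∃[ u ] (T (W u) × T (adj G v u))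

IDS : ∀ {k} → Graph k → Subset k → Set
IDS G W = Independent G W × Dominating G W

isIDS : ∀ {k} → Graph k → Subset k → Bool
isIDS G W = isIndependent G W ∧ isDominating G W

independent-reflects : ∀ {k} (G : Graph k) (W : Subset k) → T (isIndependent G W) ⇔ Independent G W
independent-reflects G W = mk⇔
  (λ t u v → to not-∧∧ (to (all-allFin _) (to (all-allFin _) t u) v))
  (λ ind → from (all-allFin _) (λ u → from (all-allFin _) (λ v → from not-∧∧ (ind u v))))

dominating-reflects : ∀ {k} (G : Graph k) (W : Subset k) → T (isDominating G W) ⇔ Dominating G W
dominating-reflects {k} G W = mk⇔
  (λ t v → map₂ neighbour (to T-∨ (to (all-allFin _) t v)))
  (λ dom → from (all-allFin _) (λ v → from T-∨ (map₂ (λ (u , wu , a) → from (any-allFin _) (u , from T-∧ (wu , a))) (dom v))))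
  where
  neighbour : ∀ {v} → T (any (λ u → W u ∧ adj G v u) (allFin k)) → ∃[ u ] (T (W u) × T (adj G v u))
  neighbour t = let (u , r) = to (any-allFin _) t in u , to T-∧ r

IDS-reflects : ∀ {k} (G : Graph k) (W : Subset k) → T (isIDS G W) ⇔ IDS G W
IDS-reflects G W = mk⇔
  (λ t → let (i , d) = to T-∧ t in to (independent-reflects G W) i , to (dominating-reflects G W) d)
  (λ (i , d) → from T-∧ (from (independent-reflects G W) i , from (dominating-reflects G W) d))

dominating-nonempty : ∀ {k} {G : Graph k} {W : Subset k} → Fin k → Dominating G W → ∃[ u ] T (W u)
dominating-nonempty v dom with dom v
... | inj₁ wv           = v , wv
... | inj₂ (u , wu , _) = u , wu

isIndependent-resp : ∀ {k} (G : Graph k) {S S′ : Subset k} → S ≐ S′ → isIndependent G S ≡ isIndependent G S′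
isIndependent-resp {k} G S≐S′ =
  cong (foldr _∧_ true) (map-cong (λ u → cong (foldr _∧_ true)
    (map-cong (λ v → cong not (cong₂ _∧_ (S≐S′ u) (cong (_∧ adj G u v) (S≐S′ v)))) (allFin k))) (allFin k))

isDominating-resp : ∀ {k} (G : Graph k) {S S′ : Subset k} → S ≐ S′ → isDominating G S ≡ isDominating G S′
isDominating-resp {k} G S≐S′ =
  cong (foldr _∧_ true) (map-cong (λ v → cong₂ _∨_ (S≐S′ v)
    (cong (foldr _∨_ false) (map-cong (λ u → cong (_∧ adj G v u) (S≐S′ u)) (allFin k)))) (allFin k))

isIDS-resp : ∀ {k} (G : Graph k) {S S′ : Subset k} → S ≐ S′ → isIDS G S ≡ isIDS G S′
isIDS-resp G S≐S′ = cong₂ _∧_ (isIndependent-resp G S≐S′) (isDominating-resp G S≐S′)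

isEmpty : ∀ {k} → Subset k → Bool
isEmpty {k} U = all (not ∘ U) (allFin k)

isEmpty-resp : ∀ {k} {S S′ : Subset k} → S ≐ S′ → isEmpty S ≡ isEmpty S′
isEmpty-resp {k} S≐S′ = cong (foldr _∧_ true) (map-cong (cong not ∘ S≐S′) (allFin k))

isEmpty-reflects : ∀ {k} (U : Subset k) → T (isEmpty U) ⇔ (∀ h → ¬ T (U h))
isEmpty-reflects U = mk⇔
  (λ t h → not-T (to (all-allFin _) t h))
  (λ e → from (all-allFin _) (λ h → T-not (e h)))
  where
  not-T : ∀ {b} → T (not b) → ¬ T b
  not-T {false} _ ()
  T-not : ∀ {b} → ¬ T b → T (not b)
  T-not {true}  ¬b = ¬b _
  T-not {false} _  = _

isEmpty-extend : ∀ {k} (U : Subset k) → isEmpty (extend false U) ≡ isEmpty U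
isEmpty-extend U = T-ext (mk⇔
  (λ t → from (isEmpty-reflects U) (λ h → to (isEmpty-reflects (extend false U)) t (suc h)))
  (λ t → from (isEmpty-reflects (extend false U)) λ { zero () ; (suc h) → to (isEmpty-reflects U) t h }))

-- Only the empty subset has weight x^0 = 1 among the subsets weighted by isEmpty.
ΣSub-isEmpty : ∀ k (x : ℚ) → ΣSub k (weight x isEmpty) ≡ 1ℚ
ΣSub-isEmpty zero    x = +-identityʳ 1ℚ
ΣSub-isEmpty (suc k) x = begin
  ΣSub (suc k) (weight x isEmpty)
    ≡⟨ ΣSub-suc k _ (weight-resp x isEmpty isEmpty-resp) ⟩
  ΣSub k (weight x isEmpty ∘ extend false) + ΣSub k (λ _ → 0ℚ)
    ≡⟨ cong₂ _+_ (trans (ΣSub-cong k omit-first) (ΣSub-isEmpty k x)) (ΣSub-zero k) ⟩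
  1ℚ + 0ℚ
    ≡⟨ +-identityʳ 1ℚ ⟩
  1ℚ ∎
  where
  omit-first : ∀ U → weight x isEmpty (extend false U) ≡ weight x isEmpty U
  omit-first U = cong₂ (λ b y → if b then y else 0ℚ) (isEmpty-extend U)
    (trans (^-card x (extend false U)) (trans (*-identityˡ _) (sym (^-card x U))))

module Corona {n m : ℕ} (G : Graph n) (H : Graph m) where

  C : Graph (n +ℕ n *ℕ m)
  C = corona G H

  base : Fin n → Fin (n +ℕ n *ℕ m)
  base v = v ↑ˡ (n *ℕ m)

  copy : Fin n → Fin m → Fin (n +ℕ n *ℕ m)
  copy v h = n ↑ʳ combine v h

  data Vertex : Fin (n +ℕ n *ℕ m) → Set where
    base-vertex : ∀ v → Vertex (base v)
    copy-vertex : ∀ v h → Vertex (copy v h)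

  vertex : ∀ a → Vertex a
  vertex a with splitAt n a in eq
  ... | inj₁ u = subst Vertex (splitAt⁻¹-↑ˡ eq) (base-vertex u)
  ... | inj₂ p = subst Vertex (trans (cong (n ↑ʳ_) (combine-remQuot {n} m p)) (splitAt⁻¹-↑ʳ eq))
                       (copy-vertex (quotient {n} m p) (remainder {n} m p))

  adj-base-base : ∀ u v → adj C (base u) (base v) ≡ adj G u v
  adj-base-base u v = cong₂ (coronaAdj′ G H) (splitAt-↑ˡ n u (n *ℕ m)) (splitAt-↑ˡ n v (n *ℕ m))

  adj-base-copy : ∀ u v h → adj C (base u) (copy v h) ≡ (u =ᶠ v)
  adj-base-copy u v h =
    trans (cong₂ (coronaAdj′ G H) (splitAt-↑ˡ n u (n *ℕ m)) (splitAt-↑ʳ n (n *ℕ m) (combine v h)))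
          (cong (λ q → u =ᶠ proj₁ q) (remQuot-combine {k = m} v h))

  adj-copy-base : ∀ v h u → adj C (copy v h) (base u) ≡ (v =ᶠ u)
  adj-copy-base v h u = trans (adj-sym C (copy v h) (base u)) (trans (adj-base-copy u v h) (=ᶠ-sym u v))

  adj-copy-copy : ∀ v h v′ h′ → adj C (copy v h) (copy v′ h′) ≡ ((v =ᶠ v′) ∧ adj H h h′)
  adj-copy-copy v h v′ h′ =
    trans (cong₂ (coronaAdj′ G H) (splitAt-↑ʳ n (n *ℕ m) (combine v h)) (splitAt-↑ʳ n (n *ℕ m) (combine v′ h′)))
          (cong₂ (λ q q′ → (proj₁ q =ᶠ proj₁ q′) ∧ adj H (proj₂ q) (proj₂ q′))
                 (remQuot-combine {k = m} v h) (remQuot-combine {k = m} v′ h′))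

  base~copy : ∀ v h → T (adj C (base v) (copy v h))
  base~copy v h = subst T (sym (adj-base-copy v v h)) (fromWitness refl)

  copy~base : ∀ v h → T (adj C (copy v h) (base v))
  copy~base v h = subst T (sym (adj-copy-base v h v)) (fromWitness refl)

  copy~copy : ∀ v h h′ → T (adj H h h′) → T (adj C (copy v h) (copy v h′))
  copy~copy v h h′ a = subst T (sym (adj-copy-copy v h v h′)) (from T-∧ (fromWitness refl , a))

  copy~copy⁻¹ : ∀ v h v′ h′ → T (adj C (copy v h) (copy v′ h′)) → v ≡ v′ × T (adj H h h′)
  copy~copy⁻¹ v h v′ h′ a =
    let (same , a′) = to T-∧ (subst T (adj-copy-copy v h v′ h′) a) in toWitness same , a′

  onG : Subset (n +ℕ n *ℕ m) → Subset n
  onG W v = W (base v)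

  onCopy : Subset (n +ℕ n *ℕ m) → Fin n → Subset m
  onCopy W v h = W (copy v h)

  CopyOK : Bool → Subset m → Set
  CopyOK b U = (T b → ∀ h → ¬ T (U h)) × (¬ T b → IDS H U)

  copyOK : Bool → Subset m → Bool
  copyOK true  U = isEmpty U
  copyOK false U = isIDS H U

  copyOK-reflects : ∀ b U → T (copyOK b U) ⇔ CopyOK b U
  copyOK-reflects true  U = mk⇔ (λ t → (λ _ → to (isEmpty-reflects U) t) , (λ ¬b → ⊥-elim (¬b _)))
                                (λ (empty , _) → from (isEmpty-reflects U) (empty _))
  copyOK-reflects false U = mk⇔ (λ t → (λ ()) , (λ _ → to (IDS-reflects H U) t))
                                (λ (_ , ids) → from (IDS-reflects H U) (ids (λ ())))

  copyOK-resp : ∀ b {U U′} → U ≐ U′ → copyOK b U ≡ copyOK b U′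
  copyOK-resp true  = isEmpty-resp
  copyOK-resp false = isIDS-resp H

  module _ (W : Subset (n +ℕ n *ℕ m)) where

    IDS⇒traces : IDS C W → Independent G (onG W) × (∀ v → CopyOK (onG W v) (onCopy W v))
    IDS⇒traces (ind , dom) = independent-on-G , copy-ok
      where
      independent-on-G : Independent G (onG W)
      independent-on-G u v wu wv a = ind (base u) (base v) wu wv (subst T (sym (adj-base-base u v)) a)

      copy-ok : ∀ v → CopyOK (onG W v) (onCopy W v)
      copy-ok v = (λ wv h wh → ind (base v) (copy v h) wv wh (base~copy v h)) , unchosen
        where
        unchosen : ¬ T (onG W v) → IDS H (onCopy W v)
        unchosen ¬wv = (λ h h′ wh wh′ a → ind (copy v h) (copy v h′) wh wh′ (copy~copy v h h′ a)) , dominated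
          where
          -- a neighbour of copy v h in W cannot be the unchosen base vertex v
          neighbour : ∀ {h a} → Vertex a → T (W a) → T (adj C (copy v h) a) →
                      T (onCopy W v h) ⊎ ∃[ h′ ] (T (onCopy W v h′) × T (adj H h h′))
          neighbour {h} (base-vertex u) wu a with refl ← toWitness (subst T (adj-copy-base v h u) a) = ⊥-elim (¬wv wu)
          neighbour {h} (copy-vertex v′ h′) wa a with copy~copy⁻¹ v h v′ h′ a
          ... | refl , a′ = inj₂ (h′ , wa , a′)

          dominated : Dominating H (onCopy W v)
          dominated h with dom (copy v h)
          ... | inj₁ wh           = inj₁ wh
          ... | inj₂ (a , wa , e) = neighbour (vertex a) wa e

    -- Sufficiency, when H has a vertex h₀ (so that an IDS of a copy dominates its base vertex).
    module _ (h₀ : Fin m) (indG : Independent G (onG W)) (ok : ∀ v → CopyOK (onG W v) (onCopy W v)) where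

      occupied-copy : ∀ v h → T (onCopy W v h) → ¬ T (onG W v) × IDS H (onCopy W v)
      occupied-copy v h wh with T? (onG W v)
      ... | yes wv = ⊥-elim (proj₁ (ok v) wv h wh)
      ... | no ¬wv = ¬wv , proj₂ (ok v) ¬wv

      traces⇒independent : Independent C W
      traces⇒independent a b wa wb = go (vertex a) (vertex b) wa wb
        where
        go : ∀ {a b} → Vertex a → Vertex b → T (W a) → T (W b) → ¬ T (adj C a b)
        go (base-vertex u) (base-vertex u′) wu wu′ e = indG u u′ wu wu′ (subst T (adj-base-base u u′) e)
        go (base-vertex u) (copy-vertex v h) wu wh e with refl ← toWitness (subst T (adj-base-copy u v h) e) =
          proj₁ (ok u) wu h wh
        go (copy-vertex v h) (base-vertex u) wh wu e with refl ← toWitness (subst T (adj-copy-base v h u) e) =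
          proj₁ (ok v) wu h wh
        go (copy-vertex v h) (copy-vertex v′ h′) wh wh′ e with copy~copy⁻¹ v h v′ h′ e
        ... | refl , a = proj₁ (proj₂ (occupied-copy v h wh)) h h′ wh wh′ a

      traces⇒dominating : Dominating C W
      traces⇒dominating a = go (vertex a)
        where
        go : ∀ {a} → Vertex a → T (W a) ⊎ ∃[ b ] (T (W b) × T (adj C a b))
        go (base-vertex u) with T? (onG W u)
        ... | yes wu = inj₁ wu
        ... | no ¬wu with dominating-nonempty {G = H} h₀ (proj₂ (proj₂ (ok u) ¬wu))
        ...   | h , wh = inj₂ (copy u h , wh , base~copy u h)
        go (copy-vertex v h) with T? (onG W v)
        ... | yes wv = inj₂ (base v , wv , copy~base v h)
        ... | no ¬wv with proj₂ (proj₂ (ok v) ¬wv) h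
        ...   | inj₁ wh             = inj₁ wh
        ...   | inj₂ (h′ , wh′ , a) = inj₂ (copy v h′ , wh′ , copy~copy v h h′ a)

    corona-IDS : Fin m → isIDS C W ≡ isIndependent G (onG W) ∧ all (λ v → copyOK (onG W v) (onCopy W v)) (allFin n)
    corona-IDS h₀ = T-ext (mk⇔
      (λ t → let (indG , ok) = IDS⇒traces (to (IDS-reflects C W) t) in
             from T-∧ (from (independent-reflects G _) indG , from (all-allFin _) (λ v → from (copyOK-reflects _ _) (ok v))))
      (λ t → let (indG , ok) = to T-∧ t
                 indG′ = to (independent-reflects G _) indG
                 ok′ = λ v → to (copyOK-reflects _ _) (to (all-allFin _) ok v) in
             from (IDS-reflects C W) (traces⇒independent h₀ indG′ ok′ , traces⇒dominating h₀ indG′ ok′)))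

    card-traces : ∀ x → x ^ card W ≡ x ^ card (onG W) * Π n (λ v → x ^ card (onCopy W v))
    card-traces x = begin
      x ^ card W
        ≡⟨ ^-card x W ⟩
      Π (n +ℕ n *ℕ m) (λ i → if W i then x else 1ℚ)
        ≡⟨ Π-+ n (n *ℕ m) _ ⟩
      Π n (λ v → if onG W v then x else 1ℚ) * Π (n *ℕ m) (λ j → if W (n ↑ʳ j) then x else 1ℚ)
        ≡⟨ cong₂ _*_ (sym (^-card x (onG W))) (Π-blocks n m _) ⟩
      x ^ card (onG W) * Π n (λ v → Π m (λ h → if onCopy W v h then x else 1ℚ))
        ≡⟨ cong (x ^ card (onG W) *_) (Π-cong n (λ v → sym (^-card x (onCopy W v)))) ⟩
      x ^ card (onG W) * Π n (λ v → x ^ card (onCopy W v)) ∎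

    weight-traces : Fin m → ∀ x →
      weight x (isIDS C) W ≡ weight x (isIndependent G) (onG W) * Π n (λ v → weight x (copyOK (onG W v)) (onCopy W v))
    weight-traces h₀ x = begin
      weight x (isIDS C) W
        ≡⟨ cong₂ (λ b y → if b then y else 0ℚ) (corona-IDS h₀) (card-traces x) ⟩
      (if isIndependent G (onG W) ∧ copiesOK then x ^ card (onG W) * copyWeights else 0ℚ)
        ≡⟨ split-indicator (isIndependent G (onG W)) copiesOK ⟩
      weight x (isIndependent G) (onG W) * (if copiesOK then copyWeights else 0ℚ)
        ≡⟨ cong (weight x (isIndependent G) (onG W) *_) (sym (Π-indicator n (λ v → copyOK (onG W v) (onCopy W v)) (λ v → v) _)) ⟩
      weight x (isIndependent G) (onG W) * Π n (λ v → weight x (copyOK (onG W v)) (onCopy W v)) ∎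
      where
      copiesOK = all (λ v → copyOK (onG W v) (onCopy W v)) (allFin n)
      copyWeights = Π n (λ v → x ^ card (onCopy W v))
      split-indicator : ∀ a b → (if a ∧ b then x ^ card (onG W) * copyWeights else 0ℚ) ≡
                                (if a then x ^ card (onG W) else 0ℚ) * (if b then copyWeights else 0ℚ)
      split-indicator true  true  = refl
      split-indicator true  false = sym (*-zeroʳ (x ^ card (onG W)))
      split-indicator false b     = sym (*-zeroˡ (if b then copyWeights else 0ℚ))

  weight-⊕ : Fin m → ∀ x (S : Subset n) (T : Subset (n *ℕ m)) →
    weight x (isIDS C) (S ⊕ T) ≡ weight x (isIndependent G) S * Π n (λ v → weight x (copyOK (S v)) (slice T v))
  weight-⊕ h₀ x S T =
    trans (weight-traces (S ⊕ T) h₀ x)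
      (cong₂ _*_ (weight-resp x _ (isIndependent-resp G) onG≐S)
                 (Π-cong n (λ v → trans (cong (λ b → weight x (copyOK b) (onCopy (S ⊕ T) v)) (onG≐S v))
                                        (weight-resp x _ (copyOK-resp (S v)) (λ h → ⊕-right n (n *ℕ m) S T (combine v h))))))
    where
    onG≐S : onG (S ⊕ T) ≐ S
    onG≐S = ⊕-left n (n *ℕ m) S T

  ΣSub-copy : ∀ x b → ΣSub m (weight x (copyOK b)) ≡ (if b then 1ℚ else ID H x)
  ΣSub-copy x true  = ΣSub-isEmpty m x
  ΣSub-copy x false = refl

mainTheorem3 : (n m : ℕ) → 1 ≤ n → 1 ≤ m → (G : Graph n) → (H : Graph m) →
    (x : ℚ) → .{{_ : NonZero (ID H x)}} →
    ID (corona G H) x ≡ (ID H x ^ n) * I G (x ÷ ID H x)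
mainTheorem3 n (suc m) _ (s≤s _) G H x = begin
  ΣSub (n +ℕ n *ℕ suc m) (weight x (isIDS C))
    ≡⟨ ΣSub-split n (n *ℕ suc m) _ (weight-resp x _ (isIDS-resp C)) ⟩
  ΣSub n (λ S → ΣSub (n *ℕ suc m) (λ T → weight x (isIDS C) (S ⊕ T)))
    ≡⟨ ΣSub-cong n (λ S → trans (ΣSub-cong (n *ℕ suc m) (weight-⊕ zero x S)) (sym (ΣSub-scale (n *ℕ suc m) (weight x (isIndependent G) S) _))) ⟩
  ΣSub n (λ S → weight x (isIndependent G) S * ΣSub (n *ℕ suc m) (λ T → Π n (λ v → weight x (copyOK (S v)) (slice T v))))
    ≡⟨ ΣSub-cong n (λ S → cong (weight x (isIndependent G) S *_)
         (trans (ΣΠ n (suc m) (λ v → weight x (copyOK (S v))) (λ v → weight-resp x _ (copyOK-resp (S v))))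
                (Π-cong n (λ v → ΣSub-copy x (S v))))) ⟩
  ΣSub n (λ S → weight x (isIndependent G) S * Π n (λ v → if S v then 1ℚ else D))
    ≡⟨ ΣSub-cong n (weight-rescale D x (isIndependent G)) ⟩
  ΣSub n (λ S → D ^ n * weight (x ÷ D) (isIndependent G) S)
    ≡⟨ sym (ΣSub-scale n (D ^ n) _) ⟩
  D ^ n * I G (x ÷ D) ∎
  where
  open Corona G H
  D = ID H x
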